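{- Let $r\ge 3$, let $\mathcal{B}=\{b_1,\dots,b_r\}$ be a set of $r$ distinct nonnegative integers, let $3\le L\le r$, and let $M\subseteq[n]$ be an $R_L$-sum-free set with $R=\mathcal{B}$. Let $\mathcal{H}_M$ be the hypergraph with vertex parts $V_1,\dots,V_r$ (pairwise disjoint copies of the integers, i.e. $V_j=\{j\}\times\mathbb{Z}$) whose edges are $A(y,m)=\{(1,y+b_1m),(2,y+b_2m),\dots,(r,y+b_rm)\}$ for $y\in[n]$, $m\in M$. Then $\mathcal{H}_M$ is an $r$-uniform $r$-partite linear hypergraph containing no rainbow cycles of length less than $L+1$.
   Context: $[n]=\{1,\dots,n\}$. Let $R=\{b_1,\dots,b_r\}$ be a set of $r$ distinct nonnegative integers and $3\le L\le r$. A set $M$ is $R_L$-sum-free if for every integer $l$ with $3\le l\le L$ and every choice of $l$ distinct elements $b_{j_1},\dots,b_{j_l}$ of $R$, the equation $(b_{j_2}-b_{j_1})m_1+\cdots+(b_{j_l}-b_{j_{l-1}})m_{l-1}+(b_{j_1}-b_{j_l})m_l=0$ has no solution with $m_i\in M$ except $m_1=\cdots=m_l$. A hypergraph is linear if any two distinct edges share at most one vertex; it is $r$-partite ($r$-uniform) if every edge contains exactly one vertex of each part $V_1,\dots,V_r$. A cycle of length $k$ ($k\ge 3$) is a sequence $v_1,A_1,\dots,v_k,A_k,v_1$ of distinct vertices and distinct edges with $v_i,v_{i+1}\in A_i$ ($1\le i\le k-1$) and $v_k,v_1\in A_k$; it is rainbow if $v_1,\dots,v_k$ lie in pairwise different parts.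 -}

module Defs where

open import Data.Nat using (ℕ; zero; suc; _≤_; _<?_)
import Data.Nat as N
open import Data.Integer as Z using (ℤ; +_)
open import Data.Fin using (Fin; zero; suc; toℕ; fromℕ<)
open import Data.Product using (Σ; _×_; _,_)
open import Relation.Nullary using (¬_; yes; no)
open import Relation.Binary.PropositionalEquality using (_≡_)
open import Function.Definitions using (Injective)

cycSuc : ∀ {l} → Fin l → Fin l
cycSuc {suc k} i with suc (toℕ i) <? suc k
... | yes p = fromℕ< p
... | no _  = zero

sumℤ : ∀ {l} → (Fin l → ℤ) → ℤ
sumℤ {zero}  f = + 0
sumℤ {suc l} f = f zero Z.+ sumℤ (λ i → f (suc i))

-- R_L-sum-free, with R = {b j | j : Fin r} (b injective).
SumFree : ∀ {r} → (b : Fin r → ℕ) → (L : ℕ) → (M : ℕ → Set) → Set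
SumFree {r} b L M =
  ∀ (l : ℕ) → 3 ≤ l → l ≤ L →
  (js : Fin l → Fin r) → Injective _≡_ _≡_ js →
  (ms : Fin l → ℕ) → (∀ i → M (ms i)) →
  sumℤ (λ i → ((+ b (js (cycSuc i))) Z.- (+ b (js i))) Z.* (+ ms i)) ≡ + 0 →
  ∀ i i' → ms i ≡ ms i'

-- Vertices: part j and value z (V_j = {j} × ℕ; all vertices that occur are ≥ 0).
Vertex : ℕ → Set
Vertex r = Fin r × ℕ

-- Edge labels (y , m) of A(y,m).
EdgeLabel : Set
EdgeLabel = ℕ × ℕ

IsEdge : (n : ℕ) → (M : ℕ → Set) → EdgeLabel → Set
IsEdge n M (y , m) = (1 ≤ y × y ≤ n) × M m

_∈E_ : ∀ {r} {b : Fin r → ℕ} → Vertex r → EdgeLabel → Set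
_∈E_ {b = b} (j , z) (y , m) = z ≡ y N.+ b j N.* m

SameEdge : ∀ {r} (b : Fin r → ℕ) → EdgeLabel → EdgeLabel → Set
SameEdge {r} b e e' = ∀ (v : Vertex r) → (_∈E_ {b = b} v e → _∈E_ {b = b} v e') × (_∈E_ {b = b} v e' → _∈E_ {b = b} v e)

RPartite : ∀ {r} (b : Fin r → ℕ) (n : ℕ) (M : ℕ → Set) → Set
RPartite {r} b n M =
  ∀ e → IsEdge n M e → ∀ (j : Fin r) →
  Σ ℕ (λ z → _∈E_ {b = b} (j , z) e × (∀ z' → _∈E_ {b = b} (j , z') e → z' ≡ z))

Linear : ∀ {r} (b : Fin r → ℕ) (n : ℕ) (M : ℕ → Set) → Set
Linear {r} b n M =
  ∀ e e' → IsEdge n M e → IsEdge n M e' → ¬ SameEdge b e e' →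
  ∀ (u w : Vertex r) → _∈E_ {b = b} u e → _∈E_ {b = b} u e' →
  _∈E_ {b = b} w e → _∈E_ {b = b} w e' → u ≡ w

RainbowCycle : ∀ {r} (b : Fin r → ℕ) (n : ℕ) (M : ℕ → Set) (k : ℕ) → Set
RainbowCycle {r} b n M k =
  Σ (Fin k → Vertex r) λ vs → Σ (Fin k → EdgeLabel) λ es →
    (∀ i → IsEdge n M (es i)) ×
    Injective _≡_ _≡_ vs ×
    (∀ i i' → SameEdge b (es i) (es i') → i ≡ i') ×
    (∀ i → _∈E_ {b = b} (vs i) (es i)) ×
    (∀ i → _∈E_ {b = b} (vs (cycSuc i)) (es i)) ×
    Injective _≡_ _≡_ (λ i → Data.Product.proj₁ (vs i))

module Submission where

-- A vertex of part j on the edge A(y,m) is (j , y + b_j m), so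
--   * every edge meets every part in exactly one vertex (r-partiteness);
--   * two edges meeting in two different parts j ≠ j' satisfy
--     (b_j - b_j')(m - m') = 0, hence have the same slope m and then the
--     same base point y (linearity);
--   * along a closed walk v_0, A_0, v_1, A_1, …, v_{k-1}, A_{k-1}, v_0 the
--     slope m_i of A_i satisfies (b_{j_{i+1}} - b_{j_i}) m_i = v_{i+1} - v_i,
--     so the cyclic sum Σ (b_{j_{i+1}} - b_{j_i}) m_i telescopes to 0.
-- For a rainbow cycle of length 3 ≤ k ≤ L the parts j_i are distinct, so the
-- R_L-sum-free property forces m_0 = m_1; the edges A_0 and A_1 then share the
-- vertex v_1 and the slope, hence coincide, contradicting distinctness.

open import Defs
open import Data.Nat using (ℕ; _≤_; _<_; suc; zero; s≤s; _<?_)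
import Data.Nat as N
import Data.Nat.Properties as NP
open import Data.Integer as Z using (ℤ; +_)
import Data.Integer.Properties as ZP
open import Data.Integer.Solver using (module +-*-Solver)
open import Data.Fin using (Fin; zero; suc; toℕ; fromℕ; inject₁; _≟_)
import Data.Fin.Properties as FP
open import Data.Product using (_×_; _,_; proj₁; proj₂)
open import Data.Sum using (inj₁; inj₂)
open import Relation.Nullary using (¬_; yes; no)
open import Relation.Binary.PropositionalEquality
open import Function.Definitions using (Injective)
open import Data.Empty using (⊥-elim)

open +-*-Solver

sumℤ-cong : ∀ {k} {f g : Fin k → ℤ} → (∀ i → f i ≡ g i) → sumℤ f ≡ sumℤ g
sumℤ-cong {zero}  h = refl
sumℤ-cong {suc k} h = cong₂ Z._+_ (h zero) (sumℤ-cong (λ i → h (suc i)))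

sumℤ-snoc : ∀ k (f : Fin (suc k) → ℤ) →
  sumℤ f ≡ sumℤ (λ i → f (inject₁ i)) Z.+ f (fromℕ k)
sumℤ-snoc zero    f = ZP.+-comm (f zero) (+ 0)
sumℤ-snoc (suc k) f = begin
  f zero Z.+ sumℤ (λ i → f (suc i))
    ≡⟨ cong (Z._+_ (f zero)) (sumℤ-snoc k (λ i → f (suc i))) ⟩
  f zero Z.+ (sumℤ (λ i → f (suc (inject₁ i))) Z.+ f (suc (fromℕ k)))
    ≡⟨ sym (ZP.+-assoc (f zero) _ _) ⟩
  f zero Z.+ sumℤ (λ i → f (suc (inject₁ i))) Z.+ f (suc (fromℕ k)) ∎
  where open ≡-Reasoning

sumℤ-sub : ∀ {k} (f g : Fin k → ℤ) →
  sumℤ (λ i → f i Z.- g i) ≡ sumℤ f Z.- sumℤ g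
sumℤ-sub {zero}  f g = refl
sumℤ-sub {suc k} f g = begin
  (f zero Z.- g zero) Z.+ sumℤ (λ i → f (suc i) Z.- g (suc i))
    ≡⟨ cong (Z._+_ (f zero Z.- g zero)) (sumℤ-sub (λ i → f (suc i)) (λ i → g (suc i))) ⟩
  (f zero Z.- g zero) Z.+ (F Z.- G)
    ≡⟨ solve 4 (λ a b c d → (a :- b) :+ (c :- d) := (a :+ c) :- (b :+ d))
               refl (f zero) (g zero) F G ⟩
  (f zero Z.+ F) Z.- (g zero Z.+ G) ∎
  where
  open ≡-Reasoning
  F G : ℤ
  F = sumℤ (λ i → f (suc i))
  G = sumℤ (λ i → g (suc i))

cycSuc-inject₁ : ∀ {k} (i : Fin k) → cycSuc {suc k} (inject₁ i) ≡ suc i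
cycSuc-inject₁ {k} i with suc (toℕ (inject₁ i)) <? suc k
... | yes p = FP.toℕ-injective (trans (FP.toℕ-fromℕ< p) (cong suc (FP.toℕ-inject₁ i)))
... | no ¬p = ⊥-elim (¬p (s≤s (subst (N._< k) (sym (FP.toℕ-inject₁ i)) (FP.toℕ<n i))))

cycSuc-fromℕ : ∀ k → cycSuc {suc k} (fromℕ k) ≡ zero
cycSuc-fromℕ k with suc (toℕ (fromℕ k)) <? suc k
... | yes p = ⊥-elim (NP.<-irrefl (FP.toℕ-fromℕ k) (NP.≤-pred p))
... | no _  = refl

sumℤ-rotate : ∀ k (g : Fin (suc k) → ℤ) → sumℤ (λ i → g (cycSuc i)) ≡ sumℤ g
sumℤ-rotate k g = begin
  sumℤ (λ i → g (cycSuc i))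
    ≡⟨ sumℤ-snoc k (λ i → g (cycSuc i)) ⟩
  sumℤ (λ i → g (cycSuc (inject₁ i))) Z.+ g (cycSuc (fromℕ k))
    ≡⟨ cong₂ Z._+_ (sumℤ-cong (λ i → cong g (cycSuc-inject₁ i))) (cong g (cycSuc-fromℕ k)) ⟩
  sumℤ (λ i → g (suc i)) Z.+ g zero
    ≡⟨ ZP.+-comm _ (g zero) ⟩
  sumℤ g ∎
  where open ≡-Reasoning

cyclic-telescope : ∀ k (g : Fin (suc k) → ℤ) →
  sumℤ (λ i → g (cycSuc i) Z.- g i) ≡ + 0
cyclic-telescope k g = begin
  sumℤ (λ i → g (cycSuc i) Z.- g i)    ≡⟨ sumℤ-sub (λ i → g (cycSuc i)) g ⟩
  sumℤ (λ i → g (cycSuc i)) Z.- sumℤ g ≡⟨ cong (λ t → t Z.- sumℤ g) (sumℤ-rotate k g) ⟩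
  sumℤ g Z.- sumℤ g                    ≡⟨ ZP.+-inverseʳ (sumℤ g) ⟩
  + 0 ∎
  where open ≡-Reasoning

pos-line : ∀ y c m → + (y N.+ c N.* m) ≡ + y Z.+ + c Z.* + m
pos-line y c m = trans (ZP.pos-+ y (c N.* m)) (cong (Z._+_ (+ y)) (ZP.pos-* c m))

line-difference : ∀ y c c' m →
  (+ c' Z.- + c) Z.* + m ≡ + (y N.+ c' N.* m) Z.- + (y N.+ c N.* m)
line-difference y c c' m = begin
  (+ c' Z.- + c) Z.* + m
    ≡⟨ solve 4 (λ Y C C' Mm → (C' :- C) :* Mm := (Y :+ C' :* Mm) :- (Y :+ C :* Mm))
               refl (+ y) (+ c) (+ c') (+ m) ⟩
  (+ y Z.+ + c' Z.* + m) Z.- (+ y Z.+ + c Z.* + m)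
    ≡⟨ sym (cong₂ Z._-_ (pos-line y c' m) (pos-line y c m)) ⟩
  + (y N.+ c' N.* m) Z.- + (y N.+ c N.* m) ∎
  where open ≡-Reasoning

-- Two lines agreeing at two distinct coordinates c ≠ c' have the same slope,
-- since their agreement gives (c - c')(m - m') = 0.
same-slope : ∀ y y' c c' m m' → ¬ c ≡ c' →
  y N.+ c N.* m ≡ y' N.+ c N.* m' → y N.+ c' N.* m ≡ y' N.+ c' N.* m' → m ≡ m'
same-slope y y' c c' m m' c≢c' at-c at-c'
  with ZP.i*j≡0⇒i≡0∨j≡0 (+ c Z.- + c') {+ m Z.- + m'} product≡0
  where
  agree : ∀ d → y N.+ d N.* m ≡ y' N.+ d N.* m' →
          (+ y Z.+ + d Z.* + m) Z.- (+ y' Z.+ + d Z.* + m') ≡ + 0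
  agree d eq = ZP.i≡j⇒i-j≡0 (trans (sym (pos-line y d m)) (trans (cong +_ eq) (pos-line y' d m')))
  product≡0 : (+ c Z.- + c') Z.* (+ m Z.- + m') ≡ + 0
  product≡0 = begin
    (+ c Z.- + c') Z.* (+ m Z.- + m')
      ≡⟨ solve 6 (λ Y Y' C C' Mm Mm' →
                    (C :- C') :* (Mm :- Mm')
                 := ((Y :+ C :* Mm) :- (Y' :+ C :* Mm')) :- ((Y :+ C' :* Mm) :- (Y' :+ C' :* Mm')))
                 refl (+ y) (+ y') (+ c) (+ c') (+ m) (+ m') ⟩
    _ ≡⟨ cong₂ Z._-_ (agree c at-c) (agree c' at-c') ⟩
    + 0 ∎
    where open ≡-Reasoning
... | inj₁ c-c'≡0 = ⊥-elim (c≢c' (ZP.+-injective (ZP.i-j≡0⇒i≡j _ _ c-c'≡0)))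
... | inj₂ m-m'≡0 = ZP.+-injective (ZP.i-j≡0⇒i≡j _ _ m-m'≡0)

same-label : ∀ y y' c m m' → m ≡ m' → y N.+ c N.* m ≡ y' N.+ c N.* m' →
  (y , m) ≡ (y' , m')
same-label y y' c m m' refl meet = cong (_, m) (NP.+-cancelʳ-≡ (c N.* m) y y' meet)

≡⇒SameEdge : ∀ {r} (b : Fin r → ℕ) {e e' : EdgeLabel} → e ≡ e' → SameEdge b e e'
≡⇒SameEdge b refl v = (λ x → x) , (λ x → x)

-- Each summand equals v_{i+1} - v_i.
closed-walk-equation : ∀ {r} (b : Fin r → ℕ) k
  (vs : Fin (suc k) → Vertex r) (es : Fin (suc k) → EdgeLabel) →
  (∀ i → _∈E_ {b = b} (vs i) (es i)) →
  (∀ i → _∈E_ {b = b} (vs (cycSuc i)) (es i)) →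
  sumℤ (λ i → (+ b (proj₁ (vs (cycSuc i))) Z.- + b (proj₁ (vs i))) Z.* + proj₂ (es i)) ≡ + 0
closed-walk-equation b k vs es vᵢ∈Aᵢ vᵢ₊₁∈Aᵢ =
  trans (sumℤ-cong step) (cyclic-telescope k (λ i → + proj₂ (vs i)))
  where
  step : ∀ i → (+ b (proj₁ (vs (cycSuc i))) Z.- + b (proj₁ (vs i))) Z.* + proj₂ (es i)
             ≡ + proj₂ (vs (cycSuc i)) Z.- + proj₂ (vs i)
  step i = trans (line-difference (proj₁ (es i)) (b (proj₁ (vs i))) (b (proj₁ (vs (cycSuc i)))) (proj₂ (es i)))
                 (sym (cong₂ Z._-_ (cong +_ (vᵢ₊₁∈Aᵢ i)) (cong +_ (vᵢ∈Aᵢ i))))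

H-rPartite : ∀ {r} (b : Fin r → ℕ) n M → RPartite b n M
H-rPartite b n M (y , m) _ j = y N.+ b j N.* m , refl , (λ z' z'∈A → z'∈A)

-- Distinct edges share at most one vertex: two common vertices in one part
-- are equal, and common vertices in two parts would force equal edges.
H-linear : ∀ {r} (b : Fin r → ℕ) → Injective _≡_ _≡_ b → ∀ n M → Linear b n M
H-linear b b-inj n M (y , m) (y' , m') _ _ A≠A' (j , z) (j' , z') u∈A u∈A' w∈A w∈A'
  with j ≟ j'
... | yes refl = cong (j ,_) (trans u∈A (sym w∈A))
... | no j≢j' = ⊥-elim (A≠A' (≡⇒SameEdge b (same-label y y' (b j) m m' m≡m' at-j)))
  where
  at-j : y N.+ b j N.* m ≡ y' N.+ b j N.* m'
  at-j = trans (sym u∈A) u∈A'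
  m≡m' : m ≡ m'
  m≡m' = same-slope y y' (b j) (b j') m m' (λ eq → j≢j' (b-inj eq)) at-j (trans (sym w∈A) w∈A')

-- A rainbow cycle of length 3 ≤ k ≤ L would give a nontrivial solution of
-- the cyclic equation; sum-freeness makes A_0 and A_1 equal slopes, and their
-- common vertex v_1 then makes them the same edge.
H-noShortRainbowCycle : ∀ {r} (b : Fin r → ℕ) L n M → SumFree b L M →
  ∀ k → 3 ≤ k → k < suc L → ¬ RainbowCycle b n M k
H-noShortRainbowCycle b L n M sum-free k@(suc k-1@(suc (suc _))) 3≤k@(s≤s (s≤s (s≤s _))) k<1+L
  (vs , es , isEdge , _ , es-distinct , vᵢ∈Aᵢ , vᵢ₊₁∈Aᵢ , rainbow) =
  0≢1 (es-distinct zero one (≡⇒SameEdge b A₀≡A₁))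
  where
  -- since k ≥ 3, this index is cycSuc zero by computation
  one : Fin k
  one = suc zero
  0≢1 : ¬ zero ≡ one
  0≢1 ()
  m₀≡m₁ : proj₂ (es zero) ≡ proj₂ (es one)
  m₀≡m₁ = sum-free k 3≤k (NP.≤-pred k<1+L) (λ i → proj₁ (vs i)) rainbow
            (λ i → proj₂ (es i)) (λ i → proj₂ (isEdge i))
            (closed-walk-equation b k-1 vs es vᵢ∈Aᵢ vᵢ₊₁∈Aᵢ) zero one
  A₀≡A₁ : es zero ≡ es one
  A₀≡A₁ = same-label _ _ (b (proj₁ (vs one))) _ _ m₀≡m₁
            (trans (sym (vᵢ₊₁∈Aᵢ zero)) (vᵢ∈Aᵢ one))

theorem11 : (r : ℕ) → 3 ≤ r → (b : Fin r → ℕ) → Injective _≡_ _≡_ b →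
    (L : ℕ) → 3 ≤ L → L ≤ r → (n : ℕ) → (M : ℕ → Set) →
    (∀ x → M x → 1 ≤ x × x ≤ n) → SumFree b L M →
    RPartite b n M × Linear b n M ×
    (∀ k → 3 ≤ k → k < suc L → ¬ RainbowCycle b n M k)
theorem11 r _ b b-inj L _ _ n M _ sum-free =
  H-rPartite b n M , H-linear b b-inj n M , H-noShortRainbowCycle b L n M sum-free
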